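{- Let $v$ be a non-exposed vertex of degree at least one in a tree $T$ of the underlying forest, where $T$ has at most one exposed vertex, and let $\mathcal T$ be a top tree for $T$ in which all clusters are valid and the orientation invariant holds. Let $c$ be the consuming node of $v$, and run $\mathrm{prepare\_expose}(c)$. When $\mathrm{prepare\_expose}$ returns, every cluster (node of the resulting top tree) containing an edge incident to $v$ is either a point cluster or already has $v$ as a boundary vertex.
   Context: Let $F$ be a forest (the underlying forest) in which some vertices are marked as exposed. For a set $C$ of edges of $F$, a vertex $w$ is a boundary vertex of $C$ if $w$ is incident to an edge of $C$ and either $w$ is exposed or $w$ is incident to an edge of $F$ not in $C$. A cluster is a nonempty connected set of edges; it is valid if it has at most two boundary vertices; a valid cluster is a path cluster if it has exactly two boundary vertices and a point cluster if it has zero or one. A top tree for a tree $T$ of $F$ (with at least one edge) is a rooted tree in which every internal node has exactly two children and whose leaves are in bijection with the edges of $T$; each node is identified with the cluster of edges at the leaves of its subtree, every such cluster being connected and valid. The two children of an internal node share exactly one vertex, its central vertex. The consuming node of a vertex $v$ is the lowest common ancestor in the top tree of all leaves corresponding to edges incident to $v$. Orientation: each internal node has ordered children (left, right), each leaf has ordered endpoints (left, right). For a leaf, a boundary vertex is its left/right boundary vertex if it is its left/right endpoint; for an internal node, a boundary vertex is middle if it equals the central vertex, and otherwise left/right according to whether it is a boundary vertex of the left/right child. Leftmost boundary vertex: the left one if it exists, else the middle one if it exists, else none; rightmost symmetric. Orientation invariant: for every internal node, the rightmost boundary vertex of the left child and the leftmost boundary vertex of the right child exist and equal the central vertex. Two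 nodes hang off to the same side if both are left children or both are right children of their respective parents. Rotation: for a node $u$ with parent $y$ and grandparent $z$, with $a=\mathrm{sibling}(u)$, $b=\mathrm{sibling}(y)$, $\mathrm{rotate\_up}(u)$ makes $a,b$ the children of $y$ and $u,y$ the children of $z$ (other parent–child relations unchanged), then adjusts child orders and orientations (possibly reversing orientations of whole subtrees) so that the orientation invariant holds. Procedure $\mathrm{prepare\_expose}(c)$: set $\mathrm{node}=c$. While $\mathrm{node}$ is not the root: let $\mathrm{parent}$ be its parent. If $\mathrm{node}$ is a point cluster, set $\mathrm{node}=\mathrm{parent}$. Otherwise let $s=\mathrm{sibling}(\mathrm{node})$ and let $q$ be the child of $\mathrm{node}$ on the same side as $s$ (the left child of $\mathrm{node}$ if $s$ is a left child, the right child otherwise). If $q$ is a path cluster or $s$ is a point cluster: perform $\mathrm{rotate\_up}$ on the other child of $\mathrm{node}$ (the one different from $q$); if $\mathrm{node}=c$ then set $c=\mathrm{parent}$; set $\mathrm{node}=\mathrm{parent}$. Otherwise let $u=\mathrm{sibling}(\mathrm{parent})$; if $s$ and $u$ hang off to the same side perform $\mathrm{rotate\_up}(\mathrm{node})$, else perform $\mathrm{rotate\_up}(s)$ (and leave $\mathrm{node}$ unchanged). When the loop ends, return $c$. -}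

module Defs where

open import Data.Nat using (ℕ)
open import Data.List using (List; []; _∷_; _++_; [_])
open import Data.List.Membership.Propositional using (_∈_; _∉_)
open import Data.List.Relation.Unary.Any using (Any; _─_)
open import Data.List.Relation.Unary.AllPairs using (AllPairs)
open import Data.Product using (Σ; ∃; ∃-syntax; _×_; _,_)
open import Data.Sum using (_⊎_)
open import Data.Maybe using (Maybe; just; nothing; map)
open import Data.Unit using (⊤)
open import Data.Empty using (⊥)
open import Relation.Nullary using (¬_)
open import Relation.Binary.PropositionalEquality using (_≡_; _≢_)

-- Graphs: vertices are natural numbers, an edge is a pair of endpoints
-- (read as an unordered pair), a graph is a list of edges.

Edge : Set
Edge = ℕ × ℕ

Graph : Set
Graph = List Edge

Incident : ℕ → Edge → Set
Incident w (a , b) = w ≡ a ⊎ w ≡ b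

SameEdge : Edge → Edge → Set
SameEdge (a , b) (c , d) = (a ≡ c × b ≡ d) ⊎ (a ≡ d × b ≡ c)

ShareVertex : Edge → Edge → Set
ShareVertex e f = ∃[ w ] (Incident w e × Incident w f)

data VReach (G : Graph) : ℕ → ℕ → Set where
  vrefl : ∀ {x} → VReach G x x
  vstep : ∀ {x y z} → VReach G x y → ((y , z) ∈ G ⊎ (z , y) ∈ G) → VReach G x z

SimpleGraph : Graph → Set
SimpleGraph G = (∀ {a b} → (a , b) ∈ G → a ≢ b) × AllPairs (λ e f → ¬ SameEdge e f) G

Acyclic : Graph → Set
Acyclic G = ∀ {a b} (i : (a , b) ∈ G) → ¬ VReach (G ─ i) a b

Forest : Graph → Set
Forest G = SimpleGraph G × Acyclic G

data EReach (C : Graph) : Edge → Edge → Set where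
  erefl : ∀ {e} → EReach C e e
  estep : ∀ {e f g} → EReach C e f → g ∈ C → ShareVertex f g → EReach C e g

ConnectedEdges : Graph → Set
ConnectedEdges C = ∀ {e f} → e ∈ C → f ∈ C → EReach C e f

-- T is (the edge set of) a tree of the forest F with at least one edge,
-- i.e. a connected component of F with at least one edge
IsTreeOf : Graph → Graph → Set
IsTreeOf F T =
  (∃[ e ] (e ∈ T)) ×
  (∀ {e} → e ∈ T → e ∈ F) ×
  ConnectedEdges T ×
  (∀ {e f} → e ∈ T → f ∈ F → ShareVertex e f → f ∈ T)

VertexOf : Graph → ℕ → Set
VertexOf T w = ∃[ e ] (e ∈ T × Incident w e)

AtMostOneExposed : List ℕ → Graph → Set
AtMostOneExposed X T =
  ∀ w w′ → w ∈ X → w′ ∈ X → VertexOf T w → VertexOf T w′ → w ≡ w′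

-- Oriented top trees: internal nodes have ordered children (left, right),
-- leaves carry an edge with ordered endpoints (left, right).

data Dir : Set where
  L R : Dir

flip : Dir → Dir
flip L = R
flip R = L

data TT : Set where
  leaf : ℕ → ℕ → TT
  node : TT → TT → TT

leaves : TT → List Edge
leaves (leaf a b) = (a , b) ∷ []
leaves (node l r) = leaves l ++ leaves r

ch : Dir → TT → TT → TT
ch L l r = l
ch R l r = r

Pos : Set
Pos = List Dir

sub : TT → Pos → Maybe TT
sub t [] = just t
sub (leaf _ _) (_ ∷ _) = nothing
sub (node l r) (L ∷ p) = sub l p
sub (node l r) (R ∷ p) = sub r p

AllNodes : (TT → Set) → TT → Set
AllNodes P (leaf a b) = P (leaf a b)
AllNodes P (node l r) = P (node l r) × AllNodes P l × AllNodes P r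

ContainsAllInc : TT → ℕ → TT → Set
ContainsAllInc t v x = ∀ e → e ∈ leaves t → Incident v e → e ∈ leaves x

Consuming : TT → ℕ → Pos → Set
Consuming t v p =
  ∃[ x ] (sub t p ≡ just x × ContainsAllInc t v x ×
          (∀ d y → sub t (p ++ [ d ]) ≡ just y → ¬ ContainsAllInc t v y))

-- Structural part of rotate_up(u), u at position  pz ++ dy ∷ du ∷ []
-- (y at pz ++ [dy], z at pz): z gets children u and y, y gets children a b.

rotLocal : Dir → Dir → TT → Maybe TT
rotLocal dy du (leaf _ _) = nothing
rotLocal dy du (node zl zr) with ch dy zl zr
... | leaf _ _ = nothing
... | node yl yr =
  just (node (ch du yl yr) (node (ch (flip du) yl yr) (ch (flip dy) zl zr)))

modifyAt : Pos → (TT → Maybe TT) → TT → Maybe TT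
modifyAt [] f t = f t
modifyAt (_ ∷ _) f (leaf _ _) = nothing
modifyAt (L ∷ p) f (node l r) = map (λ l′ → node l′ r) (modifyAt p f l)
modifyAt (R ∷ p) f (node l r) = map (λ r′ → node l r′) (modifyAt p f r)

data RotPos (pz : Pos) (dy du : Dir) : Pos → Pos → Set where
  uPart : ∀ r → RotPos pz dy du (pz ++ dy ∷ du ∷ r) (pz ++ L ∷ r)
  aPart : ∀ r → RotPos pz dy du (pz ++ dy ∷ flip du ∷ r) (pz ++ R ∷ L ∷ r)
  bPart : ∀ r → RotPos pz dy du (pz ++ flip dy ∷ r) (pz ++ R ∷ R ∷ r)
  yPart : RotPos pz dy du (pz ++ dy ∷ []) (pz ++ R ∷ [])
  outside : ∀ {q} → (∀ d r → q ≢ pz ++ d ∷ r) → RotPos pz dy du q q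

data Reorient : TT → TT → Set where
  leafSame : ∀ {a b} → Reorient (leaf a b) (leaf a b)
  leafFlip : ∀ {a b} → Reorient (leaf a b) (leaf b a)
  nodeSame : ∀ {l r l′ r′} → Reorient l l′ → Reorient r r′ →
             Reorient (node l r) (node l′ r′)
  nodeSwap : ∀ {l r l′ r′} → Reorient l l′ → Reorient r r′ →
             Reorient (node l r) (node r′ l′)

tr : ∀ {t t′} → Reorient t t′ → Pos → Pos
tr _ [] = []
tr leafSame (d ∷ p) = d ∷ p
tr leafFlip (d ∷ p) = d ∷ p
tr (nodeSame ρl ρr) (L ∷ p) = L ∷ tr ρl p
tr (nodeSame ρl ρr) (R ∷ p) = R ∷ tr ρr p
tr (nodeSwap ρl ρr) (L ∷ p) = R ∷ tr ρl p
tr (nodeSwap ρl ρr) (R ∷ p) = L ∷ tr ρr p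

module Clusters (F : Graph) (X : List ℕ) where

  _∈C_ : Edge → TT → Set
  e ∈C x = Any (SameEdge e) (leaves x)

  Boundary : TT → ℕ → Set
  Boundary x w =
    (∃[ e ] (e ∈ leaves x × Incident w e)) ×
    (w ∈ X ⊎ ∃[ e ] (e ∈ F × Incident w e × ¬ (e ∈C x)))

  Valid : TT → Set
  Valid x = ConnectedEdges (leaves x) ×
    (∀ w₁ w₂ w₃ → Boundary x w₁ → Boundary x w₂ → Boundary x w₃ →
       w₁ ≡ w₂ ⊎ w₁ ≡ w₃ ⊎ w₂ ≡ w₃)

  PointC : TT → Set
  PointC x = Valid x × (∀ w₁ w₂ → Boundary x w₁ → Boundary x w₂ → w₁ ≡ w₂)

  PathC : TT → Set
  PathC x = Valid x × ∃[ w₁ ] ∃[ w₂ ] (w₁ ≢ w₂ × Boundary x w₁ × Boundary x w₂)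

  PointAt : TT → Pos → Set
  PointAt t q = ∃[ x ] (sub t q ≡ just x × PointC x)

  TopTreeFor : Graph → TT → Set
  TopTreeFor T t =
    (∀ {e} → e ∈ leaves t → Any (SameEdge e) T) ×
    (∀ {e} → e ∈ T → e ∈C t) ×
    AllPairs (λ e f → ¬ SameEdge e f) (leaves t) ×
    AllNodes (λ x → ConnectedEdges (leaves x)) t

  Central : TT → ℕ → Set
  Central (leaf _ _) w = ⊥
  Central (node l r) w = VertexOf (leaves l) w × VertexOf (leaves r) w

  LeftB RightB MiddleB : TT → ℕ → Set
  LeftB (leaf a b) w = Boundary (leaf a b) w × w ≡ a
  LeftB (node l r) w = Boundary (node l r) w × ¬ Central (node l r) w × Boundary l w
  RightB (leaf a b) w = Boundary (leaf a b) w × w ≡ b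
  RightB (node l r) w = Boundary (node l r) w × ¬ Central (node l r) w × Boundary r w
  MiddleB x w = Boundary x w × Central x w

  Leftmost Rightmost : TT → ℕ → Set
  Leftmost x w = LeftB x w ⊎ ((∀ w′ → ¬ LeftB x w′) × MiddleB x w)
  Rightmost x w = RightB x w ⊎ ((∀ w′ → ¬ RightB x w′) × MiddleB x w)

  OrientInv : TT → Set
  OrientInv (leaf _ _) = ⊤
  OrientInv (node l r) =
    (∃[ w ] (Central (node l r) w × Rightmost l w × Leftmost r w)) ×
    OrientInv l × OrientInv r

  -- rotate_up of the node at pz ++ dy ∷ du ∷ [] : structural rotation
  -- followed by any re-orientation making the orientation invariant hold
  record Rotated (t : TT) (pz : Pos) (dy du : Dir) (t′ : TT) : Set where
    field
      t₀    : TT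
      isRot : modifyAt pz (rotLocal dy du) t ≡ just t₀
      reo   : Reorient t₀ t′
      inv   : OrientInv t′

  -- position (in t′) of the node that was at position q (in t)
  MapPos : ∀ {t pz dy du t′} → Rotated t pz dy du t′ → Pos → Pos → Set
  MapPos {pz = pz} {dy} {du} ρ q q′ =
    ∃[ q₀ ] (RotPos pz dy du q q₀ × q′ ≡ tr (Rotated.reo ρ) q₀)

  -- PE t node c t′ c′ : the loop of prepare_expose, started in tree t with
  -- variables node, c, terminates with tree t′ and returns c′
  data PE : TT → Pos → Pos → TT → Pos → Set where
    ret : ∀ {t pc} → PE t [] pc t pc
    climb : ∀ {t p d pc tf cf x} →
      sub t (p ++ [ d ]) ≡ just x → PointC x →
      PE t p pc tf cf → PE t (p ++ [ d ]) pc tf cf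
    rotChild : ∀ {t p d pc tf cf l r t′ n′ c′} →
      sub t (p ++ [ d ]) ≡ just (node l r) → ¬ PointC (node l r) →
      (PathC (ch (flip d) l r) ⊎ PointAt t (p ++ [ flip d ])) →
      (ρ : Rotated t p d d t′) →
      MapPos ρ p n′ →
      ((pc ≡ p ++ [ d ] × MapPos ρ p c′) ⊎ (pc ≢ p ++ [ d ] × MapPos ρ pc c′)) →
      PE t′ n′ c′ tf cf → PE t (p ++ [ d ]) pc tf cf
    rotNode : ∀ {t pg dp d pc tf cf l r t′ n′ c′} →
      sub t ((pg ++ [ dp ]) ++ [ d ]) ≡ just (node l r) → ¬ PointC (node l r) →
      ¬ (PathC (ch (flip d) l r) ⊎ PointAt t ((pg ++ [ dp ]) ++ [ flip d ])) →
      d ≡ dp →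
      (ρ : Rotated t pg dp d t′) →
      MapPos ρ ((pg ++ [ dp ]) ++ [ d ]) n′ → MapPos ρ pc c′ →
      PE t′ n′ c′ tf cf → PE t ((pg ++ [ dp ]) ++ [ d ]) pc tf cf
    rotSib : ∀ {t pg dp d pc tf cf l r t′ n′ c′} →
      sub t ((pg ++ [ dp ]) ++ [ d ]) ≡ just (node l r) → ¬ PointC (node l r) →
      ¬ (PathC (ch (flip d) l r) ⊎ PointAt t ((pg ++ [ dp ]) ++ [ flip d ])) →
      d ≢ dp →
      (ρ : Rotated t pg dp (flip d) t′) →
      MapPos ρ ((pg ++ [ dp ]) ++ [ d ]) n′ → MapPos ρ pc c′ →
      PE t′ n′ c′ tf cf → PE t ((pg ++ [ dp ]) ++ [ d ]) pc tf cf

{-# OPTIONS --safe #-}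
-- The loop of prepare_expose keeps the invariant that the cluster of the current node contains
-- every edge at v and that each of its proper subclusters doing so is a point cluster.  It holds
-- at the consuming node, whose two children are edge-disjoint and neither contains all edges at v.
-- Climbing past a point cluster keeps it, and so do rotations at the grandparent, which only move
-- the current subtree; re-orientations never change clusters.  When the other child of the
-- current node is rotated up, the new cluster formed by its child q and its former sibling s
-- contains all edges at v only if q does; then q is a point cluster, hence so is s by the test of
-- the loop, and q and s meet in the central vertex of their old common ancestor, so their union
-- is a point cluster.  Finally the root is a point cluster since T has at most one exposed
-- vertex, and any other cluster at v either misses an edge at v, making v a boundary vertex, or
-- contains them all and is a point cluster by the invariant.
module Submission where

open import Defs
open import Data.Nat using (ℕ)
open import Data.Nat.Properties using (_≟_)
open import Data.List using (List; []; _∷_; _++_; [_])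
open import Data.List.Properties using (++-identityʳ; ++-identityʳ-unique; ++-cancelˡ; ++-assoc)
open import Data.List.Membership.Propositional using (_∈_; _∉_; find; lose)
import Data.List.Membership.Setoid as SetoidMembership
open import Data.List.Membership.Setoid.Properties using (∈-resp-≈)
open import Data.List.Relation.Unary.Any using (Any; here; there; any?)
open import Data.List.Relation.Unary.Any.Properties using (++⁺ˡ; ++⁺ʳ; ++⁻; ++-comm)
import Data.List.Relation.Binary.Subset.Setoid.Properties as Subset
import Data.List.Relation.Binary.Subset.Setoid as SetoidSubset
open import Data.List.Relation.Binary.Subset.Propositional using () renaming (_⊆_ to _⊆ᴾ_)
import Data.List.Relation.Binary.Disjoint.Setoid as SetoidDisjoint
import Data.List.Relation.Binary.Disjoint.Setoid.Properties as Disjoint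
open import Data.List.Relation.Unary.AllPairs using (AllPairs; []; _∷_)
open import Data.List.Relation.Unary.All using (All; []; _∷_)
import Data.List.Relation.Unary.All as All
import Data.List.Relation.Unary.All.Properties as Allₚ
open import Data.Product using (∃-syntax; _×_; _,_; proj₁; proj₂)
open import Data.Sum using (_⊎_; inj₁; inj₂)
import Data.Sum as Sum
open import Data.Empty using (⊥-elim)
open import Data.Unit using (⊤; tt)
open import Function using (_∘_)
open import Data.Maybe using (Maybe; just)
open import Level using (0ℓ)
open import Relation.Nullary using (¬_; Dec; yes; no)
open import Relation.Nullary.Decidable using (_×-dec_; _⊎-dec_)
open import Relation.Binary.Definitions using (Decidable)
open import Relation.Binary.Bundles using (Setoid)
open import Relation.Binary.Structures using (IsEquivalence)
open import Relation.Binary.PropositionalEquality using (_≡_; _≢_; refl; sym; trans; subst)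

private
  variable
    w : ℕ
    e e′ f g : Edge
    xs xs′ ys ys′ zs : Graph
    l l′ r r′ t x y z : TT
    d : Dir
    p q : Pos

SameEdge-sym : SameEdge e f → SameEdge f e
SameEdge-sym {_ , _} {_ , _} (inj₁ (refl , refl)) = inj₁ (refl , refl)
SameEdge-sym {_ , _} {_ , _} (inj₂ (refl , refl)) = inj₂ (refl , refl)

SameEdge-trans : SameEdge e f → SameEdge f g → SameEdge e g
SameEdge-trans {_ , _} {_ , _} {_ , _} (inj₁ (refl , refl)) ef = ef
SameEdge-trans {_ , _} {_ , _} {_ , _} (inj₂ (refl , refl)) (inj₁ (refl , refl)) = inj₂ (refl , refl)
SameEdge-trans {_ , _} {_ , _} {_ , _} (inj₂ (refl , refl)) (inj₂ (refl , refl)) = inj₁ (refl , refl)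

SameEdge-isEquivalence : IsEquivalence SameEdge
SameEdge-isEquivalence = record
  { refl  = inj₁ (refl , refl)
  ; sym   = SameEdge-sym
  ; trans = SameEdge-trans
  }

edgeSetoid : Setoid 0ℓ 0ℓ
edgeSetoid = record { isEquivalence = SameEdge-isEquivalence }

open SetoidMembership edgeSetoid using () renaming (_∈_ to _∈ₑ_)
open SetoidSubset edgeSetoid using () renaming (_⊆_ to _⊆ₑ_)
open SetoidDisjoint edgeSetoid using () renaming (Disjoint to Disjointₑ)

Incident-resp : SameEdge e f → Incident w e → Incident w f
Incident-resp {_ , _} {_ , _} (inj₁ (refl , refl)) i = i
Incident-resp {_ , _} {_ , _} (inj₂ (refl , refl)) (inj₁ w≡a) = inj₂ w≡a
Incident-resp {_ , _} {_ , _} (inj₂ (refl , refl)) (inj₂ w≡b) = inj₁ w≡b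

ShareVertex-resp : SameEdge e e′ → SameEdge f g → ShareVertex e f → ShareVertex e′ g
ShareVertex-resp ee′ fg (w , we , wf) = w , Incident-resp ee′ we , Incident-resp fg wf

SameEdge? : Decidable SameEdge
SameEdge? (a , b) (c , d) = ((a ≟ c) ×-dec (b ≟ d)) ⊎-dec ((a ≟ d) ×-dec (b ≟ c))

Incident? : ∀ w e → Dec (Incident w e)
Incident? w (a , b) = (w ≟ a) ⊎-dec (w ≟ b)

SameEdge⇒ShareVertex : SameEdge e f → ShareVertex e f
SameEdge⇒ShareVertex {a , _} ef = a , inj₁ refl , Incident-resp ef (inj₁ refl)

ShareVertex-sym : ShareVertex e f → ShareVertex f e
ShareVertex-sym (w , we , wf) = w , wf , we

∈ₑ-resp : SameEdge e f → e ∈ₑ xs → f ∈ₑ xs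
∈ₑ-resp = ∈-resp-≈ edgeSetoid

∈⇒∈ₑ : e ∈ xs → e ∈ₑ xs
∈⇒∈ₑ e∈xs = lose e∈xs (inj₁ (refl , refl))

⊆ᴾ⇒⊆ₑ : (∀ {e} → e ∈ xs → e ∈ₑ ys) → xs ⊆ₑ ys
⊆ᴾ⇒⊆ₑ xs⊆ys e∈xs with find e∈xs
... | f , f∈xs , ef = ∈ₑ-resp (SameEdge-sym ef) (xs⊆ys f∈xs)

infix 4 _≐_
_≐_ : Graph → Graph → Set
xs ≐ ys = xs ⊆ₑ ys × ys ⊆ₑ xs

VertexOf-resp-⊆ₑ : xs ⊆ₑ ys → VertexOf xs w → VertexOf ys w
VertexOf-resp-⊆ₑ xs⊆ys (e , e∈xs , we) with find (xs⊆ys (∈⇒∈ₑ e∈xs))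
... | e′ , e′∈ys , ee′ = e′ , e′∈ys , Incident-resp ee′ we

≐-refl : xs ≐ xs
≐-refl = (λ m → m) , (λ m → m)

≐-sym : xs ≐ ys → ys ≐ xs
≐-sym (xs⊆ys , ys⊆xs) = ys⊆xs , xs⊆ys

≐-trans : xs ≐ ys → ys ≐ zs → xs ≐ zs
≐-trans (xy , yx) (yz , zy) = (λ m → yz (xy m)) , (λ m → yx (zy m))

≐-++ : xs ≐ xs′ → ys ≐ ys′ → xs ++ ys ≐ xs′ ++ ys′
≐-++ (xx′ , x′x) (yy′ , y′y) =
  Subset.++⁺ edgeSetoid xx′ yy′ , Subset.++⁺ edgeSetoid x′x y′y

≐-++-comm : ∀ xs ys → xs ++ ys ≐ ys ++ xs
≐-++-comm xs ys = ++-comm xs ys , ++-comm ys xs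

Disjointₑ-⊆ : xs′ ⊆ₑ xs → ys′ ⊆ₑ ys → Disjointₑ xs ys → Disjointₑ xs′ ys′
Disjointₑ-⊆ x′x y′y xs#ys (e∈xs′ , e∈ys′) = xs#ys (x′x e∈xs′ , y′y e∈ys′)

EReach-trans : EReach xs e f → EReach xs f g → EReach xs e g
EReach-trans p erefl = p
EReach-trans p (estep q g∈ fg) = estep (EReach-trans p q) g∈ fg

EReach-mono : xs ⊆ᴾ ys → EReach xs e f → EReach ys e f
EReach-mono xs⊆ys erefl = erefl
EReach-mono xs⊆ys (estep p g∈ fg) = estep (EReach-mono xs⊆ys p) (xs⊆ys g∈) fg

EReach-transport : xs ⊆ₑ ys → e′ ∈ ys → SameEdge e e′ → EReach xs e f →
  ∃[ f′ ] (f′ ∈ ys × SameEdge f f′ × EReach ys e′ f′)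
EReach-transport xs⊆ys e′∈ ee′ erefl = _ , e′∈ , ee′ , erefl
EReach-transport xs⊆ys e′∈ ee′ (estep p g∈ fg) with EReach-transport xs⊆ys e′∈ ee′ p
... | f′ , f′∈ , ff′ , p′ with find (xs⊆ys (∈⇒∈ₑ g∈))
... | g′ , g′∈ , gg′ = g′ , g′∈ , gg′ , estep p′ g′∈ (ShareVertex-resp ff′ gg′ fg)

ConnectedEdges-resp-≐ : xs ≐ ys → ConnectedEdges xs → ConnectedEdges ys
ConnectedEdges-resp-≐ (xs⊆ys , ys⊆xs) conn e∈ f∈
  with find (ys⊆xs (∈⇒∈ₑ e∈)) | find (ys⊆xs (∈⇒∈ₑ f∈))
... | e₀ , e₀∈ , ee₀ | f₀ , f₀∈ , ff₀
  with EReach-transport xs⊆ys e∈ (SameEdge-sym ee₀) (conn e₀∈ f₀∈)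
... | f′ , _ , f₀f′ , p =
  estep p f∈ (SameEdge⇒ShareVertex (SameEdge-trans (SameEdge-sym f₀f′) (SameEdge-sym ff₀)))

ConnectedEdges-++ : ConnectedEdges xs → ConnectedEdges ys → e ∈ xs → f ∈ ys → ShareVertex e f →
  ConnectedEdges (xs ++ ys)
ConnectedEdges-++ {xs} cxs cys e∈ f∈ ef {g} {h} g∈ h∈ with ++⁻ xs g∈ | ++⁻ xs h∈
... | inj₁ g∈xs | inj₁ h∈xs = EReach-mono ++⁺ˡ (cxs g∈xs h∈xs)
... | inj₂ g∈ys | inj₂ h∈ys = EReach-mono (++⁺ʳ xs) (cys g∈ys h∈ys)
... | inj₁ g∈xs | inj₂ h∈ys =
  EReach-trans (EReach-mono ++⁺ˡ (cxs g∈xs e∈))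
    (EReach-trans (estep erefl (++⁺ʳ xs f∈) ef) (EReach-mono (++⁺ʳ xs) (cys f∈ h∈ys)))
... | inj₂ g∈ys | inj₁ h∈xs =
  EReach-trans (EReach-mono (++⁺ʳ xs) (cys g∈ys f∈))
    (EReach-trans (estep erefl (++⁺ˡ e∈) (ShareVertex-sym ef)) (EReach-mono ++⁺ˡ (cxs e∈ h∈xs)))

sub-ch : ∀ d l r p → sub (node l r) (d ∷ p) ≡ sub (ch d l r) p
sub-ch L l r p = refl
sub-ch R l r p = refl

sub-++ : ∀ t p q → sub t p ≡ just x → sub t (p ++ q) ≡ sub x q
sub-++ t [] q refl = refl
sub-++ (node l r) (L ∷ p) q = sub-++ l p q
sub-++ (node l r) (R ∷ p) q = sub-++ r p q

sub-∷ʳ : ∀ t p d → sub t (p ++ [ d ]) ≡ just x →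
  ∃[ l ] ∃[ r ] (sub t p ≡ just (node l r) × ch d l r ≡ x)
sub-∷ʳ (node l r) [] L refl = l , r , refl , refl
sub-∷ʳ (node l r) [] R refl = l , r , refl , refl
sub-∷ʳ (node l r) (L ∷ p) d = sub-∷ʳ l p d
sub-∷ʳ (node l r) (R ∷ p) d = sub-∷ʳ r p d

module _ {P : Edge → Set} where

  Any-ch : ∀ d l r → Any P (leaves (ch d l r)) → Any P (leaves (node l r))
  Any-ch L l r = ++⁺ˡ
  Any-ch R l r = ++⁺ʳ (leaves l)

  Any-node⁻ : ∀ d l r → Any P (leaves (node l r)) →
    Any P (leaves (ch d l r)) ⊎ Any P (leaves (ch (flip d) l r))
  Any-node⁻ L l r = ++⁻ (leaves l)
  Any-node⁻ R l r m with ++⁻ (leaves l) m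
  ... | inj₁ in-l = inj₂ in-l
  ... | inj₂ in-r = inj₁ in-r

  Any-sub : ∀ t p → sub t p ≡ just x → Any P (leaves x) → Any P (leaves t)
  Any-sub t [] refl = λ m → m
  Any-sub (node l r) (d ∷ p) eq = Any-ch d l r ∘ Any-sub (ch d l r) p (trans (sym (sub-ch d l r p)) eq)

Disjointₑ-ch : ∀ d l r → Disjointₑ (leaves l) (leaves r) →
  Disjointₑ (leaves (ch d l r)) (leaves (ch (flip d) l r))
Disjointₑ-ch L l r l#r = l#r
Disjointₑ-ch R l r l#r = Disjoint.sym edgeSetoid l#r

Strictly : (TT → Set) → TT → Set
Strictly P (leaf _ _) = ⊤
Strictly P (node l r) = AllNodes P l × AllNodes P r

module _ {P : TT → Set} where

  AllNodes-root : ∀ t → AllNodes P t → P t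
  AllNodes-root (leaf _ _) Pt = Pt
  AllNodes-root (node _ _) (Pt , _) = Pt

  Strictly-ch : ∀ d l r → Strictly P (node l r) → AllNodes P (ch d l r)
  Strictly-ch L l r (Pl , _) = Pl
  Strictly-ch R l r (_ , Pr) = Pr

  AllNodes-intro : ∀ x → P x → Strictly P x → AllNodes P x
  AllNodes-intro (leaf _ _) Px _ = Px
  AllNodes-intro (node _ _) Px Sx = Px , Sx

  Strictly-node : ∀ d l r → AllNodes P (ch d l r) → AllNodes P (ch (flip d) l r) →
    Strictly P (node l r)
  Strictly-node L l r Pl Pr = Pl , Pr
  Strictly-node R l r Pr Pl = Pl , Pr

  AllNodes-sub : ∀ t p → AllNodes P t → sub t p ≡ just x → AllNodes P x
  AllNodes-sub t [] Pt refl = Pt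
  AllNodes-sub (node l r) (d ∷ p) (_ , Pt) eq =
    AllNodes-sub (ch d l r) p (Strictly-ch d l r Pt) (trans (sym (sub-ch d l r p)) eq)

  Strictly-sub : ∀ t d p → Strictly P t → sub t (d ∷ p) ≡ just x → P x
  Strictly-sub (node l r) d p Pt eq =
    AllNodes-root _ (AllNodes-sub (ch d l r) p (Strictly-ch d l r Pt) (trans (sym (sub-ch d l r p)) eq))

Reorient-leaves : Reorient x y → leaves x ≐ leaves y
Reorient-leaves leafSame = ≐-refl
Reorient-leaves leafFlip = swap , swap
  where
  swap : ∀ {a b} → ((a , b) ∷ []) ⊆ₑ ((b , a) ∷ [])
  swap (here e≈ab) = here (SameEdge-trans e≈ab (inj₂ (refl , refl)))
Reorient-leaves (nodeSame ρl ρr) = ≐-++ (Reorient-leaves ρl) (Reorient-leaves ρr)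
Reorient-leaves (nodeSwap {l′ = l′} {r′} ρl ρr) =
  ≐-trans (≐-++ (Reorient-leaves ρl) (Reorient-leaves ρr)) (≐-++-comm (leaves l′) (leaves r′))

Reorient-sub : (ρ : Reorient x y) → ∀ p → sub x p ≡ just z →
  ∃[ z′ ] (sub y (tr ρ p) ≡ just z′ × Reorient z z′)
Reorient-sub ρ [] refl = _ , refl , ρ
Reorient-sub (nodeSame ρl ρr) (L ∷ p) = Reorient-sub ρl p
Reorient-sub (nodeSame ρl ρr) (R ∷ p) = Reorient-sub ρr p
Reorient-sub (nodeSwap ρl ρr) (L ∷ p) = Reorient-sub ρl p
Reorient-sub (nodeSwap ρl ρr) (R ∷ p) = Reorient-sub ρr p

ReorientStable : (TT → Set) → Set
ReorientStable P = ∀ {x y} → Reorient x y → P x → P y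

module _ {P : TT → Set} (stable : ReorientStable P) where

  AllNodes-Reorient : ReorientStable (AllNodes P)
  AllNodes-Reorient ρ@leafSame Px = stable ρ Px
  AllNodes-Reorient ρ@leafFlip Px = stable ρ Px
  AllNodes-Reorient ρ@(nodeSame ρl ρr) (Px , Pl , Pr) =
    stable ρ Px , AllNodes-Reorient ρl Pl , AllNodes-Reorient ρr Pr
  AllNodes-Reorient ρ@(nodeSwap ρl ρr) (Px , Pl , Pr) =
    stable ρ Px , AllNodes-Reorient ρr Pr , AllNodes-Reorient ρl Pl

  Strictly-Reorient : ReorientStable (Strictly P)
  Strictly-Reorient leafSame _ = tt
  Strictly-Reorient leafFlip _ = tt
  Strictly-Reorient (nodeSame ρl ρr) (Pl , Pr) = AllNodes-Reorient ρl Pl , AllNodes-Reorient ρr Pr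
  Strictly-Reorient (nodeSwap ρl ρr) (Pl , Pr) = AllNodes-Reorient ρr Pr , AllNodes-Reorient ρl Pl

ChildrenDisjoint : TT → Set
ChildrenDisjoint (leaf _ _) = ⊤
ChildrenDisjoint (node l r) = Disjointₑ (leaves l) (leaves r)

Distinct : TT → Set
Distinct = AllNodes ChildrenDisjoint

AllPairs-++⁻ : ∀ {R : Edge → Edge → Set} xs → AllPairs R (xs ++ ys) →
  AllPairs R xs × AllPairs R ys × All (λ e → All (R e) ys) xs
AllPairs-++⁻ [] Rys = [] , Rys , []
AllPairs-++⁻ (x ∷ xs) (Rx ∷ Rxsys) with AllPairs-++⁻ xs Rxsys
... | Rxs , Rys , Rxs-ys = (Allₚ.++⁻ˡ xs Rx ∷ Rxs) , Rys , (Allₚ.++⁻ʳ xs Rx ∷ Rxs-ys)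

Distinct-intro : ∀ t → AllPairs (λ e f → ¬ SameEdge e f) (leaves t) → Distinct t
Distinct-intro (leaf _ _) _ = tt
Distinct-intro (node l r) unique with AllPairs-++⁻ (leaves l) unique
... | unique-l , unique-r , l≉r = l#r , Distinct-intro l unique-l , Distinct-intro r unique-r
  where
  l#r : Disjointₑ (leaves l) (leaves r)
  l#r (e∈l , e∈r) with find e∈l | find e∈r
  ... | f , f∈l , ef | g , g∈r , eg =
    All.lookup (All.lookup l≉r f∈l) g∈r (SameEdge-trans (SameEdge-sym ef) eg)

ChildrenDisjoint-Reorient : ReorientStable ChildrenDisjoint
ChildrenDisjoint-Reorient leafSame _ = tt
ChildrenDisjoint-Reorient leafFlip _ = tt
ChildrenDisjoint-Reorient (nodeSame ρl ρr) =
  Disjointₑ-⊆ (proj₂ (Reorient-leaves ρl)) (proj₂ (Reorient-leaves ρr))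
ChildrenDisjoint-Reorient (nodeSwap ρl ρr) l#r =
  Disjointₑ-⊆ (proj₂ (Reorient-leaves ρr)) (proj₂ (Reorient-leaves ρl))
    (Disjoint.sym edgeSetoid l#r)

record Rearranged (x y : TT) : Set where
  constructor rearranged
  field
    leaves-≐  : leaves x ≐ leaves y
    distinct : Distinct x → Distinct y

Rearranged-refl : Rearranged x x
Rearranged-refl = rearranged ≐-refl (λ Dx → Dx)

Rearranged-trans : Rearranged x y → Rearranged y z → Rearranged x z
Rearranged-trans (rearranged xy Dxy) (rearranged yz Dyz) = rearranged (≐-trans xy yz) (Dyz ∘ Dxy)

Reorient⇒Rearranged : Reorient x y → Rearranged x y
Reorient⇒Rearranged ρ = rearranged (Reorient-leaves ρ) (AllNodes-Reorient ChildrenDisjoint-Reorient ρ)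

Rearranged-node : Rearranged l l′ → Rearranged r r′ → Rearranged (node l r) (node l′ r′)
Rearranged-node (rearranged ll′ Dll′) (rearranged rr′ Drr′) = rearranged (≐-++ ll′ rr′)
  λ (l#r , Dl , Dr) → Disjointₑ-⊆ (proj₂ ll′) (proj₂ rr′) l#r , Dll′ Dl , Drr′ Dr

Rearranged-swap : Rearranged (node l r) (node r l)
Rearranged-swap {l} {r} = rearranged (≐-++-comm (leaves l) (leaves r))
  λ (l#r , Dl , Dr) → Disjoint.sym edgeSetoid l#r , Dr , Dl

Rearranged-assoc : Rearranged (node (node x y) z) (node x (node y z))
Rearranged-assoc {x} {y} {z} = rearranged assoc distinct
  where
  assoc : (leaves x ++ leaves y) ++ leaves z ≐ leaves x ++ (leaves y ++ leaves z)
  assoc rewrite ++-assoc (leaves x) (leaves y) (leaves z) = ≐-refl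
  distinct : Distinct (node (node x y) z) → Distinct (node x (node y z))
  distinct (xy#z , (x#y , Dx , Dy) , Dz) = x#yz , Dx , (y#z , Dy , Dz)
    where
    x#yz : Disjointₑ (leaves x) (leaves y ++ leaves z)
    x#yz (e∈x , e∈yz) with ++⁻ (leaves y) e∈yz
    ... | inj₁ e∈y = x#y (e∈x , e∈y)
    ... | inj₂ e∈z = xy#z (++⁺ˡ e∈x , e∈z)
    y#z : Disjointₑ (leaves y) (leaves z)
    y#z (e∈y , e∈z) = xy#z (++⁺ʳ (leaves x) e∈y , e∈z)

rotLocal-Rearranged : ∀ dy du z → rotLocal dy du z ≡ just y → Rearranged z y
rotLocal-Rearranged L L (node (node _ _) _) refl = Rearranged-assoc
rotLocal-Rearranged L R (node (node _ _) _) refl =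
  Rearranged-trans (Rearranged-node Rearranged-swap Rearranged-refl) Rearranged-assoc
rotLocal-Rearranged R L (node _ (node _ _)) refl = Rearranged-trans Rearranged-swap Rearranged-assoc
rotLocal-Rearranged R R (node _ (node _ _)) refl =
  Rearranged-trans Rearranged-swap
    (Rearranged-trans (Rearranged-node Rearranged-swap Rearranged-refl) Rearranged-assoc)

rotLocal-sub : ∀ dy du z → rotLocal dy du z ≡ just y → ∀ p →
  sub y (L ∷ p) ≡ sub z (dy ∷ du ∷ p) ×
  sub y (R ∷ L ∷ p) ≡ sub z (dy ∷ flip du ∷ p) ×
  sub y (R ∷ R ∷ p) ≡ sub z (flip dy ∷ p)
rotLocal-sub L L (node (node _ _) _) refl p = refl , refl , refl
rotLocal-sub L R (node (node _ _) _) refl p = refl , refl , refl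
rotLocal-sub R L (node _ (node _ _)) refl p = refl , refl , refl
rotLocal-sub R R (node _ (node _ _)) refl p = refl , refl , refl

rotLocal-node : ∀ dy du zl zr {yl yr} → ch dy zl zr ≡ node yl yr →
  rotLocal dy du (node zl zr) ≡ just (node (ch du yl yr) (node (ch (flip du) yl yr) (ch (flip dy) zl zr)))
rotLocal-node L du _ _ refl = refl
rotLocal-node R du _ _ refl = refl

module _ {f : TT → Maybe TT} where

  modifyAt-Rearranged : (∀ {z y} → f z ≡ just y → Rearranged z y) →
    ∀ p t → modifyAt p f t ≡ just y → Rearranged t y
  modifyAt-Rearranged f-ok [] t eq = f-ok eq
  modifyAt-Rearranged f-ok (L ∷ p) (node l r) eq with modifyAt p f l in eqₗ
  modifyAt-Rearranged f-ok (L ∷ p) (node l r) refl | just _ =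
    Rearranged-node (modifyAt-Rearranged f-ok p l eqₗ) Rearranged-refl
  modifyAt-Rearranged f-ok (R ∷ p) (node l r) eq with modifyAt p f r in eqᵣ
  modifyAt-Rearranged f-ok (R ∷ p) (node l r) refl | just _ =
    Rearranged-node Rearranged-refl (modifyAt-Rearranged f-ok p r eqᵣ)

  modifyAt-sub : ∀ p t → modifyAt p f t ≡ just y →
    ∃[ z ] ∃[ z′ ]
      (sub t p ≡ just z × f z ≡ just z′ × (∀ q → sub y (p ++ q) ≡ sub z′ q))
  modifyAt-sub [] t eq = t , _ , refl , eq , λ q → refl
  modifyAt-sub (L ∷ p) (node l r) eq with modifyAt p f l in eqₗ
  modifyAt-sub (L ∷ p) (node l r) refl | just _ = modifyAt-sub p l eqₗ
  modifyAt-sub (R ∷ p) (node l r) eq with modifyAt p f r in eqᵣ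
  modifyAt-sub (R ∷ p) (node l r) refl | just _ = modifyAt-sub p r eqᵣ

++-∷-≢ : ∀ (p : Pos) d q → p ++ d ∷ q ≢ p
++-∷-≢ p d q eq with ++-identityʳ-unique p (sym eq)
... | ()

module _ {pz : Pos} {dy du : Dir} where

  RotPos-root : RotPos pz dy du q p → q ≡ pz → p ≡ pz
  RotPos-root (outside _) eq = eq
  RotPos-root (uPart r) eq = ⊥-elim (++-∷-≢ pz _ _ eq)
  RotPos-root (aPart r) eq = ⊥-elim (++-∷-≢ pz _ _ eq)
  RotPos-root (bPart r) eq = ⊥-elim (++-∷-≢ pz _ _ eq)
  RotPos-root yPart eq = ⊥-elim (++-∷-≢ pz _ _ eq)

  RotPos-grandchild : ∀ {t t₀} → modifyAt pz (rotLocal dy du) t ≡ just t₀ →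
    RotPos pz dy du q p → ∀ a b r → q ≡ pz ++ a ∷ b ∷ r → sub t₀ p ≡ sub t q
  RotPos-grandchild {t = t} rot (uPart r) _ _ _ _ with modifyAt-sub pz t rot
  ... | z , z′ , sz , rz , sz′ =
    trans (sz′ (L ∷ r)) (trans (proj₁ (rotLocal-sub dy du z rz r)) (sym (sub-++ t pz _ sz)))
  RotPos-grandchild {t = t} rot (aPart r) _ _ _ _ with modifyAt-sub pz t rot
  ... | z , z′ , sz , rz , sz′ =
    trans (sz′ (R ∷ L ∷ r))
      (trans (proj₁ (proj₂ (rotLocal-sub dy du z rz r))) (sym (sub-++ t pz _ sz)))
  RotPos-grandchild {t = t} rot (bPart r) _ _ _ _ with modifyAt-sub pz t rot
  ... | z , z′ , sz , rz , sz′ =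
    trans (sz′ (R ∷ R ∷ r))
      (trans (proj₂ (proj₂ (rotLocal-sub dy du z rz r))) (sym (sub-++ t pz _ sz)))
  RotPos-grandchild rot yPart a b r eq with ++-cancelˡ pz _ _ eq
  ... | ()
  RotPos-grandchild rot (outside not-below) a b r eq = ⊥-elim (not-below a (b ∷ r) eq)

module ClusterProperties (F : Graph) (X : List ℕ) where

  open Clusters F X

  Rotated⇒Rearranged : ∀ {t pz dy du t′} → Rotated t pz dy du t′ → Rearranged t t′
  Rotated⇒Rearranged {t} {pz} {dy} {du} ρ = Rearranged-trans
    (modifyAt-Rearranged (rotLocal-Rearranged dy du _) pz t (Rotated.isRot ρ))
    (Reorient⇒Rearranged (Rotated.reo ρ))

  Rotated-grandchild : ∀ {t pz dy du t′ n′ a b} (ρ : Rotated t pz dy du t′) → MapPos ρ q n′ →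
    q ≡ pz ++ a ∷ b ∷ p → sub t q ≡ just x →
    ∃[ x′ ] (sub t′ n′ ≡ just x′ × Reorient x x′)
  Rotated-grandchild ρ (q₀ , rp , refl) eq sx =
    Reorient-sub (Rotated.reo ρ) q₀ (trans (RotPos-grandchild (Rotated.isRot ρ) rp _ _ _ eq) sx)

  Rotated-root : ∀ {t pz dy du t′ n′} (ρ : Rotated t pz dy du t′) → MapPos ρ pz n′ →
    ∃[ z ] ∃[ z₀ ] ∃[ x′ ]
      (sub t pz ≡ just z × rotLocal dy du z ≡ just z₀ ×
       sub t′ n′ ≡ just x′ × Reorient z₀ x′)
  Rotated-root {t} {pz} {dy} {du} ρ (q₀ , rp , refl) with RotPos-root rp refl
  ... | refl with modifyAt-sub pz t (Rotated.isRot ρ)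
  ... | z , z₀ , sz , rz , sz₀
    with Reorient-sub (Rotated.reo ρ) pz
           (subst (λ p → sub (Rotated.t₀ ρ) p ≡ just z₀) (++-identityʳ pz) (sz₀ []))
  ... | x′ , sx′ , ρ′ = z , z₀ , x′ , sz , rz , sx′ , ρ′

  Boundary-sub : ∀ {x y} → leaves y ⊆ₑ leaves x → VertexOf (leaves y) w →
    Boundary x w → Boundary y w
  Boundary-sub y⊆x vy (_ , outer) =
    vy , Sum.map₂ (λ (g , g∈F , wg , g∉x) → g , g∈F , wg , g∉x ∘ y⊆x) outer

  PointC-intro : ∀ x → ConnectedEdges (leaves x) →
    (∀ w₁ w₂ → Boundary x w₁ → Boundary x w₂ → w₁ ≡ w₂) → PointC x
  PointC-intro x conn unique = (conn , λ w₁ w₂ w₃ b₁ b₂ _ → inj₁ (unique w₁ w₂ b₁ b₂)) , unique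

  PointC-resp-≐ : ∀ {x y} → leaves x ≐ leaves y → PointC x → PointC y
  PointC-resp-≐ {x} {y} (xy , yx) ((conn , _) , unique) =
    PointC-intro y (ConnectedEdges-resp-≐ (xy , yx) conn) λ w₁ w₂ b₁ b₂ →
      unique w₁ w₂ (to-x b₁) (to-x b₂)
    where
    to-x : Boundary y w → Boundary x w
    to-x by = Boundary-sub {x = y} {y = x} xy (VertexOf-resp-⊆ₑ yx (proj₁ by)) by

  PointC⇒¬PathC : PointC x → ¬ PathC x
  PointC⇒¬PathC (_ , unique) (_ , w₁ , w₂ , w₁≢w₂ , b₁ , b₂) = w₁≢w₂ (unique w₁ w₂ b₁ b₂)

  Boundary-node⁻ : ∀ {x y} → Boundary (node x y) w → Boundary x w ⊎ Boundary y w
  Boundary-node⁻ {w} {x} {y} bxy@((e , e∈xy , we) , _) with ++⁻ (leaves x) e∈xy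
  ... | inj₁ e∈x = inj₁ (Boundary-sub {x = node x y} {y = x} ++⁺ˡ (e , e∈x , we) bxy)
  ... | inj₂ e∈y = inj₂ (Boundary-sub {x = node x y} {y = y} (++⁺ʳ (leaves x)) (e , e∈y , we) bxy)

  shared-vertex-Boundary : ∀ {x y} → Disjointₑ (leaves x) (leaves y) → leaves y ⊆ₑ F →
    VertexOf (leaves x) w → VertexOf (leaves y) w → Boundary x w
  shared-vertex-Boundary x#y y⊆F vx (f , f∈y , wf) with find (y⊆F (∈⇒∈ₑ f∈y))
  ... | g , g∈F , fg = vx ,
    inj₂ (g , g∈F , Incident-resp fg wf , λ g∈x → x#y (∈ₑ-resp (SameEdge-sym fg) g∈x , ∈⇒∈ₑ f∈y))

  PointC-node : ∀ x y → PointC x → PointC y → VertexOf (leaves x) w → VertexOf (leaves y) w →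
    Disjointₑ (leaves x) (leaves y) → leaves x ⊆ₑ F → leaves y ⊆ₑ F → PointC (node x y)
  PointC-node {w} x y ((conn-x , _) , unique-x) ((conn-y , _) , unique-y)
    vx@(e , e∈x , we) vy@(f , f∈y , wf) x#y x⊆F y⊆F =
    PointC-intro (node x y) (ConnectedEdges-++ conn-x conn-y e∈x f∈y (w , we , wf))
      λ w₁ w₂ b₁ b₂ → trans (is-w b₁) (sym (is-w b₂))
    where
    is-w : ∀ {b} → Boundary (node x y) b → b ≡ w
    is-w {b} bb with Boundary-node⁻ {x = x} {y} bb
    ... | inj₁ bx = unique-x b w bx (shared-vertex-Boundary {x = x} {y} x#y y⊆F vx vy)
    ... | inj₂ by =
      unique-y b w by (shared-vertex-Boundary {x = y} {x} (Disjoint.sym edgeSetoid x#y) x⊆F vy vx)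

  root-PointC : ∀ {T} t → leaves t ≐ T → ConnectedEdges T → AtMostOneExposed X T →
    (∀ {e f} → e ∈ T → f ∈ F → ShareVertex e f → f ∈ T) → PointC t
  root-PointC {T} t (t⊆T , T⊆t) conn-T one-exposed closed =
    PointC-intro t (ConnectedEdges-resp-≐ (T⊆t , t⊆T) conn-T) λ w₁ w₂ b₁ b₂ →
      let w₁∈X , w₁∈T = exposed b₁
          w₂∈X , w₂∈T = exposed b₂
      in one-exposed w₁ w₂ w₁∈X w₂∈X w₁∈T w₂∈T
    where
    exposed : ∀ {b} → Boundary t b → b ∈ X × VertexOf T b
    exposed {b} (vt , outer) with VertexOf-resp-⊆ₑ t⊆T vt
    ... | e , e∈T , be = Sum.[ (λ b∈X → b∈X) , ⊥-elim ∘ inside ]′ outer , e , e∈T , be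
      where
      inside : ¬ (∃[ g ] (g ∈ F × Incident b g × ¬ g ∈ₑ leaves t))
      inside (g , g∈F , bg , g∉t) = g∉t (T⊆t (∈⇒∈ₑ (closed e∈T g∈F (b , be , bg))))

  Leftmost⇒VertexOf : ∀ x → Leftmost x w → VertexOf (leaves x) w
  Leftmost⇒VertexOf (leaf _ _) (inj₁ (bx , _)) = proj₁ bx
  Leftmost⇒VertexOf (node _ _) (inj₁ (bx , _)) = proj₁ bx
  Leftmost⇒VertexOf x (inj₂ (_ , bx , _)) = proj₁ bx

  Rightmost⇒VertexOf : ∀ x → Rightmost x w → VertexOf (leaves x) w
  Rightmost⇒VertexOf (leaf _ _) (inj₁ (bx , _)) = proj₁ bx
  Rightmost⇒VertexOf (node _ _) (inj₁ (bx , _)) = proj₁ bx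
  Rightmost⇒VertexOf x (inj₂ (_ , bx , _)) = proj₁ bx

  Leftmost-node⇒left : ∀ l r → Leftmost (node l r) w → VertexOf (leaves l) w
  Leftmost-node⇒left _ _ (inj₁ (_ , _ , bl)) = proj₁ bl
  Leftmost-node⇒left _ _ (inj₂ (_ , _ , vl , _)) = vl

  Rightmost-node⇒right : ∀ l r → Rightmost (node l r) w → VertexOf (leaves r) w
  Rightmost-node⇒right _ _ (inj₁ (_ , _ , br)) = proj₁ br
  Rightmost-node⇒right _ _ (inj₂ (_ , _ , _ , vr)) = vr

  OrientInv-sub : ∀ t p → OrientInv t → sub t p ≡ just x → OrientInv x
  OrientInv-sub t [] oi refl = oi
  OrientInv-sub (node l r) (L ∷ p) (_ , oi-l , _) = OrientInv-sub l p oi-l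
  OrientInv-sub (node l r) (R ∷ p) (_ , _ , oi-r) = OrientInv-sub r p oi-r

  inner-grandchild-meets-uncle : ∀ d zl zr → OrientInv (node zl zr) → ch d zl zr ≡ node l r →
    ∃[ w ] (VertexOf (leaves (ch (flip d) l r)) w × VertexOf (leaves (ch (flip d) zl zr)) w)
  inner-grandchild-meets-uncle {l} {r} L _ zr ((w , _ , rm , lm) , _) refl =
    w , Rightmost-node⇒right l r rm , Leftmost⇒VertexOf zr lm
  inner-grandchild-meets-uncle {l} {r} R zl _ ((w , _ , rm , lm) , _) refl =
    w , Leftmost-node⇒left l r lm , Rightmost⇒VertexOf zl rm

module Expose (F : Graph) (X : List ℕ) (T : Graph) (v : ℕ)
  (T⊆F : ∀ {e} → e ∈ T → e ∈ F)
  (closed : ∀ {e f} → e ∈ T → f ∈ F → ShareVertex e f → f ∈ T)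
  {ev : Edge} (ev∈T : ev ∈ T) (v∈ev : Incident v ev) where

  open Clusters F X
  open ClusterProperties F X

  Consumes : Graph → Set
  Consumes xs = ∀ e → e ∈ F → Incident v e → e ∈ₑ xs

  PointIfConsumes : TT → Set
  PointIfConsumes x = Consumes (leaves x) → PointC x

  Consumes-⊆ : xs ⊆ₑ ys → Consumes xs → Consumes ys
  Consumes-⊆ xs⊆ys cxs e e∈F ve = xs⊆ys (cxs e e∈F ve)

  ¬Consumes-both : Disjointₑ xs ys → Consumes xs → ¬ Consumes ys
  ¬Consumes-both xs#ys cxs cys = xs#ys (cxs ev (T⊆F ev∈T) v∈ev , cys ev (T⊆F ev∈T) v∈ev)

  nonconsuming-AllNodes : ∀ x → ¬ Consumes (leaves x) → AllNodes PointIfConsumes x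
  nonconsuming-AllNodes (leaf _ _) ¬cx cx = ⊥-elim (¬cx cx)
  nonconsuming-AllNodes (node l r) ¬cx =
    (λ cx → ⊥-elim (¬cx cx)) ,
    nonconsuming-AllNodes l (¬cx ∘ Consumes-⊆ ++⁺ˡ) ,
    nonconsuming-AllNodes r (¬cx ∘ Consumes-⊆ (++⁺ʳ (leaves l)))

  PointIfConsumes-Reorient : ReorientStable PointIfConsumes
  PointIfConsumes-Reorient {x} {y} ρ px cy =
    PointC-resp-≐ {x} {y} (Reorient-leaves ρ) (px (Consumes-⊆ (proj₂ (Reorient-leaves ρ)) cy))

  Settled : TT → Set
  Settled x = Consumes (leaves x) × Strictly PointIfConsumes x

  ExposeInv : TT → Pos → Set
  ExposeInv t n = ∃[ x ] (sub t n ≡ just x × Settled x)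

  WellFormed : TT → Set
  WellFormed t = OrientInv t × Distinct t × leaves t ≐ T

  ExposeInv-at : ExposeInv t p → sub t p ≡ just x → Settled x
  ExposeInv-at (x , sx , settled) sx′ with trans (sym sx) sx′
  ... | refl = settled

  Settled-Reorient : ReorientStable Settled
  Settled-Reorient ρ (cx , strict) =
    Consumes-⊆ (proj₁ (Reorient-leaves ρ)) cx , Strictly-Reorient PointIfConsumes-Reorient ρ strict

  WellFormed-Rotated : ∀ {t pz dy du t′} → Rotated t pz dy du t′ → WellFormed t → WellFormed t′
  WellFormed-Rotated ρ (_ , Dt , t≐T) =
    Rotated.inv ρ , Rearranged.distinct rearr Dt , ≐-trans (≐-sym (Rearranged.leaves-≐ rearr)) t≐T
    where
    rearr : Rearranged _ _
    rearr = Rotated⇒Rearranged ρ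

  Settled-parent : ∀ d l r → Distinct (node l r) → PointC (ch d l r) → Settled (ch d l r) →
    Settled (node l r)
  Settled-parent d l r (l#r , _) point (consumes , strict) =
    Consumes-⊆ (Any-ch d l r) consumes ,
    Strictly-node d l r (AllNodes-intro (ch d l r) (λ _ → point) strict)
      (nonconsuming-AllNodes (ch (flip d) l r) (¬Consumes-both (Disjointₑ-ch d l r l#r) consumes))

  climb-step : ∀ t p d → WellFormed t → sub t (p ++ [ d ]) ≡ just x → PointC x →
    ExposeInv t (p ++ [ d ]) → ExposeInv t p
  climb-step t p d (_ , Dt , _) sx point inv with sub-∷ʳ t p d sx
  ... | l , r , sp , refl =
    node l r , sp ,
    Settled-parent d l r (AllNodes-sub t p Dt sp) point (ExposeInv-at {t = t} {p = p ++ [ d ]} inv sx)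

  Strictly-rotated-parent : ∀ d l r s → Disjointₑ (leaves (node l r)) (leaves s) →
    VertexOf (leaves (ch (flip d) l r)) w → VertexOf (leaves s) w →
    leaves (node l r) ⊆ₑ F → leaves s ⊆ₑ F → Settled (node l r) →
    PathC (ch (flip d) l r) ⊎ PointC s →
    Strictly PointIfConsumes (node (ch d l r) (node (ch (flip d) l r) s))
  Strictly-rotated-parent d l r s lr#s vA vs lr⊆F s⊆F (c-lr , strict) cond =
    Strictly-ch d l r strict , point-As , all-A , nonconsuming-AllNodes s (¬Consumes-both lr#s c-lr)
    where
    A : TT
    A = ch (flip d) l r
    all-A : AllNodes PointIfConsumes A
    all-A = Strictly-ch (flip d) l r strict
    point-As : PointIfConsumes (node A s)
    point-As c-As = PointC-node A s pA ps vA vs A#s (lr⊆F ∘ Any-ch (flip d) l r) s⊆F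
      where
      A#s : Disjointₑ (leaves A) (leaves s)
      A#s = Disjointₑ-⊆ (Any-ch (flip d) l r) (λ m → m) lr#s
      c-A : Consumes (leaves A)
      c-A e e∈F ve with ++⁻ (leaves A) (c-As e e∈F ve)
      ... | inj₁ e∈A = e∈A
      ... | inj₂ e∈s = ⊥-elim (lr#s (c-lr e e∈F ve , e∈s))
      pA : PointC A
      pA = AllNodes-root A all-A c-A
      ps : PointC s
      ps = Sum.[ ⊥-elim ∘ PointC⇒¬PathC {x = A} pA , (λ point → point) ]′ cond

  T⊆ₑF : T ⊆ₑ F
  T⊆ₑF = ⊆ᴾ⇒⊆ₑ (∈⇒∈ₑ ∘ T⊆F)

  rotate-child-step : ∀ t p d {l r t′ n′} → WellFormed t →
    sub t (p ++ [ d ]) ≡ just (node l r) →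
    PathC (ch (flip d) l r) ⊎ PointAt t (p ++ [ flip d ]) →
    (ρ : Rotated t p d d t′) → MapPos ρ p n′ → ExposeInv t (p ++ [ d ]) → ExposeInv t′ n′
  rotate-child-step t p d {l} {r} (oi , Dt , t⊆T , _) sx cond ρ mp inv
    with sub-∷ʳ t p d sx | Rotated-root ρ mp
  ... | zl , zr , sz , eq | z , z₀ , x′ , sz′ , rz , sx′ , ρ′ with trans (sym sz′) sz
  ... | refl with trans (sym rz) (rotLocal-node d d zl zr eq)
  ... | refl = x′ , sx′ , Settled-Reorient ρ′ (Consumes-⊆ lr⊆z₀ c-lr , strict)
    where
    lr⊆z : leaves (node l r) ⊆ₑ leaves (node zl zr)
    lr⊆z = subst (λ y → leaves y ⊆ₑ leaves (node zl zr)) eq (Any-ch d zl zr)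
    lr⊆z₀ : leaves (node l r) ⊆ₑ leaves z₀
    lr⊆z₀ = proj₁ (Rearranged.leaves-≐ (rotLocal-Rearranged d d (node zl zr) rz)) ∘ lr⊆z
    z⊆F : leaves (node zl zr) ⊆ₑ F
    z⊆F = T⊆ₑF ∘ t⊆T ∘ Any-sub t p sz
    zl#zr : Disjointₑ (leaves zl) (leaves zr)
    zl#zr = proj₁ (AllNodes-sub t p Dt sz)
    lr#s : Disjointₑ (leaves (node l r)) (leaves (ch (flip d) zl zr))
    lr#s = subst (λ y → Disjointₑ (leaves y) (leaves (ch (flip d) zl zr))) eq
      (Disjointₑ-ch d zl zr zl#zr)
    settled : Settled (node l r)
    settled = ExposeInv-at {t = t} {p = p ++ [ d ]} inv sx
    c-lr : Consumes (leaves (node l r))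
    c-lr = proj₁ settled
    uncle-point : PointAt t (p ++ [ flip d ]) → PointC (ch (flip d) zl zr)
    uncle-point (s , ss , ps)
      with trans (sym ss) (trans (sub-++ t p [ flip d ] sz) (sub-ch (flip d) zl zr []))
    ... | refl = ps
    strict : Strictly PointIfConsumes z₀
    strict with inner-grandchild-meets-uncle d zl zr (OrientInv-sub t p oi sz) eq
    ... | w , vA , vs = Strictly-rotated-parent d l r (ch (flip d) zl zr) lr#s vA vs
      (z⊆F ∘ lr⊆z) (z⊆F ∘ Any-ch (flip d) zl zr) settled (Sum.map₂ uncle-point cond)

  rotate-grandparent-step : ∀ {t pz dy du t′ q n′ a b} → (ρ : Rotated t pz dy du t′) →
    MapPos ρ q n′ → q ≡ pz ++ a ∷ b ∷ p → ExposeInv t q → ExposeInv t′ n′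
  rotate-grandparent-step ρ mq eq (x , sx , settled) with Rotated-grandchild ρ mq eq sx
  ... | x′ , sx′ , ρ′ = x′ , sx′ , Settled-Reorient ρ′ settled

  prepare-expose-inv : ∀ {t n c t′ c′} → PE t n c t′ c′ → WellFormed t → ExposeInv t n →
    WellFormed t′ × ExposeInv t′ []
  prepare-expose-inv ret wf inv = wf , inv
  prepare-expose-inv (climb {t = t} {p} {d} sx point pe) wf inv =
    prepare-expose-inv pe wf (climb-step t p d wf sx point inv)
  prepare-expose-inv (rotChild {t = t} {p} {d} sx _ cond ρ mp _ pe) wf inv =
    prepare-expose-inv pe (WellFormed-Rotated ρ wf) (rotate-child-step t p d wf sx cond ρ mp inv)
  prepare-expose-inv (rotNode {pg = pg} {dp} {d} _ _ _ _ ρ mp _ pe) wf inv =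
    prepare-expose-inv pe (WellFormed-Rotated ρ wf)
      (rotate-grandparent-step ρ mp (++-assoc pg [ dp ] [ d ]) inv)
  prepare-expose-inv (rotSib {pg = pg} {dp} {d} _ _ _ _ ρ mp _ pe) wf inv =
    prepare-expose-inv pe (WellFormed-Rotated ρ wf)
      (rotate-grandparent-step ρ mp (++-assoc pg [ dp ] [ d ]) inv)

  consuming-child-contains-all : ∀ t d l r → leaves t ⊆ₑ T → Disjointₑ (leaves l) (leaves r) →
    ContainsAllInc t v (node l r) → Consumes (leaves (ch d l r)) → ContainsAllInc t v (ch d l r)
  consuming-child-contains-all t d l r t⊆T l#r contains-all c-y g g∈t vg
    with Any-node⁻ d l r (contains-all g g∈t vg)
  ... | inj₁ g∈y = g∈y
  ... | inj₂ g∈y′ with find (t⊆T (∈⇒∈ₑ g∈t))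
  ... | g′ , g′∈T , gg′ = ⊥-elim (Disjointₑ-ch d l r l#r
    (∈ₑ-resp (SameEdge-sym gg′) (c-y g′ (T⊆F g′∈T) (Incident-resp gg′ vg)) , ∈⇒∈ₑ g∈y′))

  ExposeInv-consuming : ∀ t c → WellFormed t → Consuming t v c → ExposeInv t c
  ExposeInv-consuming t c (_ , Dt , t⊆T , T⊆t) (x , sx , contains-all , minimal) =
    x , sx , consumes , no-proper-consumer x sx contains-all (AllNodes-sub t c Dt sx)
    where
    consumes : Consumes (leaves x)
    consumes e e∈F ve with find (T⊆t (∈⇒∈ₑ (closed ev∈T e∈F (v , v∈ev , ve))))
    ... | g , g∈t , eg = lose (contains-all g g∈t (Incident-resp eg ve)) eg
    no-proper-consumer : ∀ y → sub t c ≡ just y → ContainsAllInc t v y → Distinct y →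
      Strictly PointIfConsumes y
    no-proper-consumer (leaf _ _) _ _ _ = tt
    no-proper-consumer (node l r) sy contains-all-lr (l#r , _) =
      Strictly-node L l r (nonconsuming-AllNodes l (¬consumes L)) (nonconsuming-AllNodes r (¬consumes R))
      where
      ¬consumes : ∀ d → ¬ Consumes (leaves (ch d l r))
      ¬consumes d = minimal d (ch d l r) (trans (sub-++ t c [ d ] sy) (sub-ch d l r []))
        ∘ consuming-child-contains-all t d l r t⊆T l#r contains-all-lr

  consumes? : ∀ G xs →
    (∀ e → e ∈ G → Incident v e → e ∈ₑ xs) ⊎ ∃[ g ] (g ∈ G × Incident v g × ¬ g ∈ₑ xs)
  consumes? [] xs = inj₁ λ _ ()
  consumes? (g ∷ G) xs with consumes? G xs | Incident? v g | any? (SameEdge? g) xs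
  ... | inj₂ (h , h∈G , vh , h∉xs) | _ | _ = inj₂ (h , there h∈G , vh , h∉xs)
  ... | inj₁ _ | yes vg | no g∉xs = inj₂ (g , here refl , vg , g∉xs)
  ... | inj₁ all | yes _ | yes g∈xs =
    inj₁ λ { _ (here refl) _ → g∈xs ; h (there h∈G) → all h h∈G }
  ... | inj₁ all | no ¬vg | _ =
    inj₁ λ { _ (here refl) vg → ⊥-elim (¬vg vg) ; h (there h∈G) → all h h∈G }

  point-or-boundary : ∀ t → WellFormed t → ExposeInv t [] →
    ConnectedEdges T → AtMostOneExposed X T →
    ∀ p → sub t p ≡ just x → VertexOf (leaves x) v → PointC x ⊎ Boundary x v
  point-or-boundary t (_ , _ , t≐T) _ conn-T one-exposed [] refl _ =
    inj₁ (root-PointC t t≐T conn-T one-exposed closed)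
  point-or-boundary {x} t _ (_ , refl , _ , strict) _ _ (d ∷ p) sx vx with consumes? F (leaves x)
  ... | inj₁ c-x = inj₁ (Strictly-sub t d p strict sx c-x)
  ... | inj₂ outer = inj₂ (vx , inj₂ outer)

open Clusters

lemmaA1 : (F : Graph) (X : List ℕ) (T : Graph) (v : ℕ) (t : TT) (c : Pos) →
    Forest F → IsTreeOf F T → AtMostOneExposed X T →
    v ∉ X → (∃[ e ] (e ∈ T × Incident v e)) →
    TopTreeFor F X T t → AllNodes (Valid F X) t → OrientInv F X t →
    Consuming t v c →
    (t′ : TT) (c′ : Pos) → PE F X t c c t′ c′ →
    (p : Pos) (x : TT) → sub t′ p ≡ just x →
    (∃[ e ] (e ∈ leaves x × Incident v e)) →
    PointC F X x ⊎ Boundary F X x v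
lemmaA1 F X T v t c _ (_ , T⊆F , conn-T , closed) one-exposed _ (_ , ev∈T , v∈ev)
  (t⊆T , T⊆t , unique , _) _ oi consuming t′ c′ pe p x sx vx =
  point-or-boundary t′ (proj₁ final) (proj₂ final) conn-T one-exposed p sx vx
  where
  open Expose F X T v T⊆F closed ev∈T v∈ev
  initial : WellFormed t
  initial = oi , Distinct-intro t unique , ⊆ᴾ⇒⊆ₑ t⊆T , ⊆ᴾ⇒⊆ₑ T⊆t
  final : WellFormed t′ × ExposeInv t′ []
  final = prepare-expose-inv pe initial (ExposeInv-consuming t c initial consuming)
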